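{- For every integer $q\geq 2$, $C(3,q)=[2q/3]^2\,(q-[2q/3])$, where $[x]$ denotes the nearest integer to the real number $x$. In particular, \[ \lim_{q\rightarrow\infty}\frac{C(3,q)}{q^3/3}=\frac49. \]
   Context: Let $F$ be a finite alphabet with $|F|=q$. Two words $u,v\in F^n$ (not necessarily distinct) are overlapping if a non-empty proper prefix of $u$ equals a non-empty proper suffix of $v$, or a non-empty proper prefix of $v$ equals a non-empty proper suffix of $u$. A code $C\subseteq F^n$ is non-overlapping if for all (not necessarily distinct) $u,v\in C$, the words $u$ and $v$ are not overlapping. $C(n,q)$ denotes the maximum cardinality of a non-overlapping code $C\subseteq F^n$ with $|F|=q$. -}

module Defs where

open import Data.Nat using (ℕ; zero; suc; _+_; _*_; _∸_; _≤_; _<_; NonZero)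
open import Data.Nat.DivMod using (_/_)
open import Data.Fin using (Fin)
open import Data.Vec using (Vec; toList)
open import Data.List using (List; length; take; drop)
open import Data.List.Membership.Propositional using (_∈_)
open import Data.List.Relation.Unary.Unique.Propositional using (Unique)
open import Data.Product using (Σ; ∃; _×_)
open import Data.Sum using (_⊎_)
open import Relation.Nullary using (¬_)
open import Relation.Binary.PropositionalEquality using (_≡_)

Word : ℕ → ℕ → Set
Word q n = Vec (Fin q) n

prefix : ∀ {q n} → ℕ → Word q n → List (Fin q)
prefix k u = take k (toList u)

suffix : ∀ {q n} → ℕ → Word q n → List (Fin q)
suffix {n = n} k v = drop (n ∸ k) (toList v)

Overlapping : ∀ {q n} → Word q n → Word q n → Set
Overlapping {n = n} u v =
  ∃ λ k → (0 < k) × (k < n) × ((prefix k u ≡ suffix k v) ⊎ (prefix k v ≡ suffix k u))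

-- A code is a finite set of words, represented as a duplicate-free list.
Code : ℕ → ℕ → Set
Code q n = List (Word q n)

NonOverlapping : ∀ {q n} → Code q n → Set
NonOverlapping C = ∀ {u v} → u ∈ C → v ∈ C → ¬ Overlapping u v

-- N is the maximum cardinality of a non-overlapping code in F^n, |F| = q,
-- i.e. C(n,q) = N.
IsMaxNonOverlapping : ℕ → ℕ → ℕ → Set
IsMaxNonOverlapping n q N =
  (Σ (Code q n) λ C → Unique C × NonOverlapping C × length C ≡ N)
  × (∀ (C : Code q n) → Unique C → NonOverlapping C → length C ≤ N)

-- Nearest integer to the rational a / b (b > 0), rounding halves up:
-- [a/b] = ⌊a/b + 1/2⌋ = ⌊(2a + b) / (2b)⌋.
nearest : (a b : ℕ) → .{{NonZero b}} → ℕ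
nearest a (suc b) = (2 * a + suc b) / (2 * suc b)

-- Let C ⊆ F³ be non-overlapping, I the set of first letters and F the set of last letters of
-- its words, and G the letters in neither. Overlaps of length one force I ∩ F = ∅; overlaps of
-- length two force the sets of length-two prefixes and suffixes to be disjoint. Counting the
-- words with a fixed middle letter m by their prefix when m ∈ F, by their suffix when m ∈ I,
-- and by (first, last) letter otherwise, the prefixes (x, m) with m ∈ F and the suffixes
-- (x, y) with x ∈ I inject disjointly into I × F, so with c = max(|I|,|F|) and d = min:
--   |C| ≤ c·|I||F| + |G||I||F| = (c + |G|)·c·d ≤ (c + |G|)²·d,   where (c + |G|) + d = q.
-- The maximum of x²y over x + y = q is attained at x = [2q/3], and the code of all words
-- (a, m, b) with a, m among the first [2q/3] letters and b among the others attains it.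
module Submission where

open import Defs
open import Algebra.Properties.CommutativeSemigroup using (x∙yz≈y∙xz)
open import Data.Empty using (⊥-elim)
open import Data.Fin as Fin using (Fin; _↑ˡ_; _↑ʳ_; splitAt)
open import Data.Fin.Patterns using (0F; 1F; 2F)
open import Data.Fin.Properties using (↑ˡ-injective; ↑ʳ-injective; splitAt-↑ˡ; splitAt-↑ʳ)
open import Data.List using (List; []; _∷_; length; map; allFin; cartesianProduct)
open import Data.List.Membership.Propositional using (_∈_; find)
open import Data.List.Membership.Propositional.Properties using (∈-map⁻)
open import Data.List.Properties using (length-map; length-++; length-tabulate; ∷-injectiveˡ; ∷-injectiveʳ)
open import Data.List.Relation.Unary.Any as Any using (Any; here; there; any?)
open import Data.List.Relation.Unary.AllPairs using (_∷_)
open import Data.List.Relation.Unary.Unique.Propositional using (Unique)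
open import Data.List.Relation.Unary.Unique.Propositional.Properties using (Unique[x∷xs]⇒x∉xs; map⁺; cartesianProduct⁺; allFin⁺)
open import Data.Nat using (ℕ; zero; suc; _+_; _*_; _∸_; _≤_; _<_; z≤n; s≤s; NonZero)
open import Data.Nat.Divisibility using (n∣m*n)
open import Data.Nat.DivMod using (_/_; /-congˡ; +-distrib-/-∣ʳ; m<n⇒m/n≡0; m*n/n≡m)
open import Data.Nat.Properties
open import Data.Nat.Tactic.RingSolver using (solve)
open import Data.Product using (∃₂; _×_; _,_; <_,_>; proj₁; proj₂)
open import Data.Sum using (inj₁; inj₂)
open import Data.Vec using (lookup)
open import Data.Vec.Properties using (≡-dec)
open import Function using (_∘_)
open import Relation.Binary.Definitions using (DecidableEquality)
open import Relation.Binary.PropositionalEquality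
open import Relation.Nullary using (Dec; yes; no; ¬_; ¬?)
open import Relation.Nullary.Decidable using (_×-dec_)
open import Relation.Unary using (Decidable)

open import Algebra.Properties.Semiring.Sum +-*-semiring
  using (sum; sum-syntax; sum-cong-≗; ∑-distrib-+; ∑-comm; *-distribˡ-sum; *-distribʳ-sum)

∑-mono-≤ : ∀ {n} {f g : Fin n → ℕ} → (∀ i → f i ≤ g i) → sum f ≤ sum g
∑-mono-≤ {zero}  f≤g = z≤n
∑-mono-≤ {suc n} f≤g = +-mono-≤ (f≤g 0F) (∑-mono-≤ (f≤g ∘ Fin.suc))

term≤∑ : ∀ {n} (f : Fin n → ℕ) i → f i ≤ sum f
term≤∑ f Fin.zero    = m≤m+n _ _
term≤∑ f (Fin.suc i) = m≤n⇒m≤o+n (f 0F) (term≤∑ (f ∘ Fin.suc) i)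

∑-ones : ∀ n → ∑[ i < n ] 1 ≡ n
∑-ones zero    = refl
∑-ones (suc n) = cong suc (∑-ones n)

∑∑-* : ∀ {m n} (f : Fin m → ℕ) (g : Fin n → ℕ) → ∑[ i < m ] ∑[ j < n ] (f i * g j) ≡ sum f * sum g
∑∑-* f g = trans (sum-cong-≗ λ i → sym (*-distribˡ-sum (f i) g)) (sym (*-distribʳ-sum (sum g) f))

≤-convex : ∀ i j k {x X Y Z} → i + j + k ≡ 1 → x ≤ X → x ≤ Y → x ≤ Z → x ≤ i * X + j * Y + k * Z
≤-convex i j k {x} {X} {Y} {Z} i+j+k≡1 x≤X x≤Y x≤Z = begin
  x                         ≡⟨ *-identityˡ x ⟨
  1 * x                     ≡⟨ cong (_* x) i+j+k≡1 ⟨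
  (i + j + k) * x           ≡⟨ solve (i ∷ j ∷ k ∷ x ∷ []) ⟩
  i * x + j * x + k * x     ≤⟨ +-mono-≤ (+-mono-≤ (*-monoʳ-≤ i x≤X) (*-monoʳ-≤ j x≤Y)) (*-monoʳ-≤ k x≤Z) ⟩
  i * X + j * Y + k * Z     ∎
  where open ≤-Reasoning

𝟙 : {P : Set} → Dec P → ℕ
𝟙 (yes _) = 1
𝟙 (no _)  = 0

𝟙-yes : {P : Set} (p : Dec P) → P → 𝟙 p ≡ 1
𝟙-yes (yes _) _  = refl
𝟙-yes (no ¬p) p = ⊥-elim (¬p p)

𝟙-mono : {P Q : Set} → (P → Q) → (p : Dec P) (q : Dec Q) → 𝟙 p ≤ 𝟙 q
𝟙-mono P⇒Q (no _)  q = z≤n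
𝟙-mono P⇒Q (yes p) q = ≤-reflexive (sym (𝟙-yes q (P⇒Q p)))

𝟙-× : {P Q : Set} (p : Dec P) (q : Dec Q) → 𝟙 (p ×-dec q) ≡ 𝟙 p * 𝟙 q
𝟙-× (yes _) (yes _) = refl
𝟙-× (yes _) (no _)  = refl
𝟙-× (no _)  _       = refl

𝟙-disjoint : {P Q R : Set} → (P → R) → (Q → R) → ¬ (P × Q) →
             (p : Dec P) (q : Dec Q) (r : Dec R) → 𝟙 p + 𝟙 q ≤ 𝟙 r
𝟙-disjoint P⇒R Q⇒R P∩Q=∅ (yes p) (yes q) r = ⊥-elim (P∩Q=∅ (p , q))
𝟙-disjoint P⇒R Q⇒R P∩Q=∅ (yes p) (no _)  r = ≤-reflexive (sym (𝟙-yes r (P⇒R p)))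
𝟙-disjoint P⇒R Q⇒R P∩Q=∅ (no _)  q       r = 𝟙-mono Q⇒R q r

𝟙-partition : {P Q : Set} → ¬ (P × Q) → (p : Dec P) (q : Dec Q) → 𝟙 p + 𝟙 q + 𝟙 (¬? p ×-dec ¬? q) ≡ 1
𝟙-partition P∩Q=∅ (yes p) (yes q) = ⊥-elim (P∩Q=∅ (p , q))
𝟙-partition P∩Q=∅ (yes _) (no _)  = refl
𝟙-partition P∩Q=∅ (no _)  (yes _) = refl
𝟙-partition P∩Q=∅ (no _)  (no _)  = refl

module _ {q : ℕ} where

  open import Data.Vec using ([]; _∷_)

  _≟W_ : DecidableEquality (Word q 3)
  _≟W_ = ≡-dec Fin._≟_

  open import Data.List.Membership.DecPropositional _≟W_ using (_∈?_)

  overlapping-1 : {u v : Word q 3} → lookup u 0F ≡ lookup v 2F → Overlapping u v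
  overlapping-1 {_ ∷ _ ∷ _ ∷ []} {_ ∷ _ ∷ _ ∷ []} eq = 1 , s≤s z≤n , s≤s (s≤s z≤n) , inj₁ (cong (_∷ []) eq)

  overlapping-2 : {u v : Word q 3} → lookup u 0F ≡ lookup v 1F → lookup u 1F ≡ lookup v 2F → Overlapping u v
  overlapping-2 {_ ∷ _ ∷ _ ∷ []} {_ ∷ _ ∷ _ ∷ []} eq₀ eq₁ =
    2 , s≤s z≤n , s≤s (s≤s (s≤s z≤n)) , inj₁ (cong₂ (λ a b → a ∷ b ∷ []) eq₀ eq₁)

  word : Fin q → Fin q → Fin q → Word q 3
  word a m b = a ∷ m ∷ b ∷ []

  ∑W : (Word q 3 → ℕ) → ℕ
  ∑W f = ∑[ m < q ] ∑[ a < q ] ∑[ b < q ] f (word a m b)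

  ∑W-mono-≤ : {f g : Word q 3 → ℕ} → (∀ w → f w ≤ g w) → ∑W f ≤ ∑W g
  ∑W-mono-≤ f≤g = ∑-mono-≤ λ m → ∑-mono-≤ λ a → ∑-mono-≤ λ b → f≤g (word a m b)

  ∑W-distrib-+ : (f g : Word q 3 → ℕ) → ∑W (λ w → f w + g w) ≡ ∑W f + ∑W g
  ∑W-distrib-+ f g = trans (sum-cong-≗ λ m → trans (sum-cong-≗ λ a → ∑-distrib-+ (f ∘ word a m) (g ∘ word a m))
                                                   (∑-distrib-+ (∑b f m) (∑b g m)))
                           (∑-distrib-+ (∑ab f) (∑ab g))
    where
    ∑b : (Word q 3 → ℕ) → Fin q → Fin q → ℕ
    ∑b h m a = ∑[ b < q ] h (word a m b)
    ∑ab : (Word q 3 → ℕ) → Fin q → ℕ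
    ∑ab h m = ∑[ a < q ] ∑b h m a

  term≤∑W : (f : Word q 3 → ℕ) (w : Word q 3) → f w ≤ ∑W f
  term≤∑W f (a ∷ m ∷ b ∷ []) = ≤-trans (term≤∑ _ b) (≤-trans (term≤∑ _ a) (term≤∑ _ m))

  length≤∑W∈ : {L : List (Word q 3)} → Unique L → length L ≤ ∑W (λ w → 𝟙 (w ∈? L))
  length≤∑W∈ {[]}    _                           = z≤n
  length≤∑W∈ {w ∷ L} wL-unique@(_ ∷ L-unique) = begin
    1 + length L
      ≤⟨ +-mono-≤ 1≤∑W≡w (length≤∑W∈ {L} L-unique) ⟩
    ∑W (λ v → 𝟙 (v ≟W w)) + ∑W (λ v → 𝟙 (v ∈? L))
      ≡⟨ ∑W-distrib-+ (λ v → 𝟙 (v ≟W w)) (λ v → 𝟙 (v ∈? L)) ⟨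
    ∑W (λ v → 𝟙 (v ≟W w) + 𝟙 (v ∈? L))
      ≤⟨ ∑W-mono-≤ (λ v → 𝟙-disjoint here there v∉ (v ≟W w) (v ∈? L) (v ∈? (w ∷ L))) ⟩
    ∑W (λ v → 𝟙 (v ∈? (w ∷ L)))
      ∎
    where
    open ≤-Reasoning
    1≤∑W≡w : 1 ≤ ∑W (λ v → 𝟙 (v ≟W w))
    1≤∑W≡w = ≤-trans (≤-reflexive (sym (𝟙-yes (w ≟W w) refl))) (term≤∑W (λ v → 𝟙 (v ≟W w)) w)
    v∉ : ∀ {v} → ¬ (v ≡ w × v ∈ L)
    v∉ (refl , v∈L) = Unique[x∷xs]⇒x∉xs wL-unique v∈L

  module Counting (C : Code q 3) (C-nonOverlapping : NonOverlapping C) where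

    Initial Final : Fin q → Set
    Initial x = Any (λ w → lookup w 0F ≡ x) C
    Final   x = Any (λ w → lookup w 2F ≡ x) C

    Prefix Suffix : Fin q → Fin q → Set
    Prefix x y = Any (λ w → lookup w 0F ≡ x × lookup w 1F ≡ y) C
    Suffix x y = Any (λ w → lookup w 1F ≡ x × lookup w 2F ≡ y) C

    initial? : Decidable Initial
    initial? x = any? (λ w → lookup w 0F Fin.≟ x) C

    final? : Decidable Final
    final? x = any? (λ w → lookup w 2F Fin.≟ x) C

    prefix? : ∀ x y → Dec (Prefix x y)
    prefix? x y = any? (λ w → (lookup w 0F Fin.≟ x) ×-dec (lookup w 1F Fin.≟ y)) C

    suffix? : ∀ x y → Dec (Suffix x y)
    suffix? x y = any? (λ w → (lookup w 1F Fin.≟ x) ×-dec (lookup w 2F Fin.≟ y)) C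

    initial-final-disjoint : ∀ {x} → ¬ (Initial x × Final x)
    initial-final-disjoint (ux , vx) with find ux | find vx
    ... | u , u∈C , u₀≡x | v , v∈C , v₂≡x = C-nonOverlapping u∈C v∈C (overlapping-1 (trans u₀≡x (sym v₂≡x)))

    prefix-suffix-disjoint : ∀ {x y} → ¬ (Prefix x y × Suffix x y)
    prefix-suffix-disjoint (uxy , vxy) with find uxy | find vxy
    ... | u , u∈C , u₀≡x , u₁≡y | v , v∈C , v₁≡x , v₂≡y =
      C-nonOverlapping u∈C v∈C (overlapping-2 (trans u₀≡x (sym v₁≡x)) (trans u₁≡y (sym v₂≡y)))

    unused? : Decidable (λ x → ¬ Initial x × ¬ Final x)
    unused? x = ¬? (initial? x) ×-dec ¬? (final? x)

    |I| |F| |G| : ℕ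
    |I| = ∑[ x < q ] 𝟙 (initial? x)
    |F| = ∑[ x < q ] 𝟙 (final? x)
    |G| = ∑[ x < q ] 𝟙 (unused? x)

    prefixesTo suffixesFrom : Fin q → ℕ
    prefixesTo   m = ∑[ x < q ] 𝟙 (prefix? x m)
    suffixesFrom m = ∑[ y < q ] 𝟙 (suffix? m y)

    |P| |S| : ℕ
    |P| = ∑[ m < q ] (𝟙 (final? m) * prefixesTo m)
    |S| = ∑[ m < q ] (𝟙 (initial? m) * suffixesFrom m)

    |I|+|F|+|G|≡q : |I| + |F| + |G| ≡ q
    |I|+|F|+|G|≡q = begin
      |I| + |F| + |G|
        ≡⟨ cong (_+ |G|) (∑-distrib-+ (𝟙 ∘ initial?) (𝟙 ∘ final?)) ⟨
      ∑[ x < q ] (𝟙 (initial? x) + 𝟙 (final? x)) + |G|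
        ≡⟨ ∑-distrib-+ (λ x → 𝟙 (initial? x) + 𝟙 (final? x)) (𝟙 ∘ unused?) ⟨
      ∑[ x < q ] (𝟙 (initial? x) + 𝟙 (final? x) + 𝟙 (unused? x))
        ≡⟨ sum-cong-≗ (λ x → 𝟙-partition initial-final-disjoint (initial? x) (final? x)) ⟩
      ∑[ x < q ] 1
        ≡⟨ ∑-ones q ⟩
      q ∎
      where open ≡-Reasoning

    ∈⇒initial : ∀ {a m b} → word a m b ∈ C → Initial a
    ∈⇒initial = Any.map λ { refl → refl }

    ∈⇒final : ∀ {a m b} → word a m b ∈ C → Final b
    ∈⇒final = Any.map λ { refl → refl }

    ∈⇒prefix : ∀ {a m b} → word a m b ∈ C → Prefix a m
    ∈⇒prefix = Any.map λ { refl → refl , refl }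

    ∈⇒suffix : ∀ {a m b} → word a m b ∈ C → Suffix m b
    ∈⇒suffix = Any.map λ { refl → refl , refl }

    I-part F-part G-part : Fin q → ℕ
    I-part m = 𝟙 (initial? m) * (|I| * suffixesFrom m)
    F-part m = 𝟙 (final? m) * (prefixesTo m * |F|)
    G-part m = 𝟙 (unused? m) * (|I| * |F|)

    column : Fin q → ℕ
    column m = ∑[ a < q ] ∑[ b < q ] 𝟙 (word a m b ∈? C)

    column≤ : ∀ {A B : Fin q → Set} (A? : Decidable A) (B? : Decidable B) m →
              (∀ {a b} → word a m b ∈ C → A a × B b) →
              column m ≤ (∑[ a < q ] 𝟙 (A? a)) * (∑[ b < q ] 𝟙 (B? b))
    column≤ A? B? m amb∈C⇒AB = begin
      column m
        ≤⟨ ∑-mono-≤ (λ a → ∑-mono-≤ λ b → 𝟙-mono amb∈C⇒AB (word a m b ∈? C) (A? a ×-dec B? b)) ⟩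
      ∑[ a < q ] ∑[ b < q ] 𝟙 (A? a ×-dec B? b)
        ≡⟨ sum-cong-≗ (λ a → sum-cong-≗ λ b → 𝟙-× (A? a) (B? b)) ⟩
      ∑[ a < q ] ∑[ b < q ] (𝟙 (A? a) * 𝟙 (B? b))
        ≡⟨ ∑∑-* (𝟙 ∘ A?) (𝟙 ∘ B?) ⟩
      (∑[ a < q ] 𝟙 (A? a)) * (∑[ b < q ] 𝟙 (B? b))
        ∎
      where open ≤-Reasoning

    column≤weighted : ∀ m → column m ≤ I-part m + F-part m + G-part m
    column≤weighted m = ≤-convex (𝟙 (initial? m)) (𝟙 (final? m)) (𝟙 (unused? m))
      (𝟙-partition initial-final-disjoint (initial? m) (final? m))
      (column≤ initial? (suffix? m) m < ∈⇒initial , ∈⇒suffix >)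
      (column≤ (λ x → prefix? x m) final? m < ∈⇒prefix , ∈⇒final >)
      (column≤ initial? final? m < ∈⇒initial , ∈⇒final >)

    |P|+|S|≤|I|*|F| : |P| + |S| ≤ |I| * |F|
    |P|+|S|≤|I|*|F| = begin
      |P| + |S|
        ≡⟨ cong₂ _+_ |P|≡∑∑pre |S|≡∑∑suf ⟩
      ∑[ x < q ] ∑[ y < q ] pre x y + ∑[ x < q ] ∑[ y < q ] suf x y
        ≡⟨ ∑∑-distrib-+ ⟨
      ∑[ x < q ] ∑[ y < q ] (pre x y + suf x y)
        ≤⟨ ∑-mono-≤ (λ x → ∑-mono-≤ (pre+suf≤ x)) ⟩
      ∑[ x < q ] ∑[ y < q ] (𝟙 (initial? x) * 𝟙 (final? y))
        ≡⟨ ∑∑-* (𝟙 ∘ initial?) (𝟙 ∘ final?) ⟩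
      |I| * |F|
        ∎
      where
      open ≤-Reasoning
      pre suf : Fin q → Fin q → ℕ
      pre x y = 𝟙 (final? y) * 𝟙 (prefix? x y)
      suf x y = 𝟙 (initial? x) * 𝟙 (suffix? x y)

      |P|≡∑∑pre : |P| ≡ ∑[ x < q ] ∑[ y < q ] pre x y
      |P|≡∑∑pre = trans (sum-cong-≗ λ y → *-distribˡ-sum (𝟙 (final? y)) (λ x → 𝟙 (prefix? x y)))
                        (∑-comm (λ y x → pre x y))

      |S|≡∑∑suf : |S| ≡ ∑[ x < q ] ∑[ y < q ] suf x y
      |S|≡∑∑suf = sum-cong-≗ λ x → *-distribˡ-sum (𝟙 (initial? x)) (𝟙 ∘ suffix? x)

      ∑∑-distrib-+ : ∑[ x < q ] ∑[ y < q ] (pre x y + suf x y)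
                   ≡ ∑[ x < q ] ∑[ y < q ] pre x y + ∑[ x < q ] ∑[ y < q ] suf x y
      ∑∑-distrib-+ = trans (sum-cong-≗ λ x → ∑-distrib-+ (pre x) (suf x))
                           (∑-distrib-+ (λ x → ∑[ y < q ] pre x y) (λ x → ∑[ y < q ] suf x y))

      pre+suf≤ : ∀ x y → pre x y + suf x y ≤ 𝟙 (initial? x) * 𝟙 (final? y)
      pre+suf≤ x y = begin
        pre x y + suf x y
          ≡⟨ cong₂ _+_ (𝟙-× (final? y) (prefix? x y)) (𝟙-× (initial? x) (suffix? x y)) ⟨
        𝟙 (final? y ×-dec prefix? x y) + 𝟙 (initial? x ×-dec suffix? x y)
          ≤⟨ 𝟙-disjoint pre⇒IF suf⇒IF pre∩suf=∅
               (final? y ×-dec prefix? x y) (initial? x ×-dec suffix? x y) (initial? x ×-dec final? y) ⟩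
        𝟙 (initial? x ×-dec final? y)
          ≡⟨ 𝟙-× (initial? x) (final? y) ⟩
        𝟙 (initial? x) * 𝟙 (final? y)
          ∎
        where
        pre⇒IF : Final y × Prefix x y → Initial x × Final y
        pre⇒IF (fy , pxy) = Any.map proj₁ pxy , fy
        suf⇒IF : Initial x × Suffix x y → Initial x × Final y
        suf⇒IF (ix , sxy) = ix , Any.map proj₂ sxy
        pre∩suf=∅ : ¬ ((Final y × Prefix x y) × (Initial x × Suffix x y))
        pre∩suf=∅ ((_ , pxy) , (_ , sxy)) = prefix-suffix-disjoint (pxy , sxy)

    length≤ : Unique C → length C ≤ |I| * |S| + |P| * |F| + |G| * (|I| * |F|)
    length≤ C-unique = begin
      length C
        ≤⟨ length≤∑W∈ C-unique ⟩
      ∑[ m < q ] column m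
        ≤⟨ ∑-mono-≤ column≤weighted ⟩
      ∑[ m < q ] (I-part m + F-part m + G-part m)
        ≡⟨ ∑-distrib-+ (λ m → I-part m + F-part m) G-part ⟩
      ∑[ m < q ] (I-part m + F-part m) + ∑[ m < q ] G-part m
        ≡⟨ cong (_+ ∑[ m < q ] G-part m) (∑-distrib-+ I-part F-part) ⟩
      ∑[ m < q ] I-part m + ∑[ m < q ] F-part m + ∑[ m < q ] G-part m
        ≡⟨ cong₂ _+_ (cong₂ _+_ ∑I-part ∑F-part) (sym (*-distribʳ-sum (|I| * |F|) (𝟙 ∘ unused?))) ⟩
      |I| * |S| + |P| * |F| + |G| * (|I| * |F|)
        ∎
      where
      open ≤-Reasoning
      ∑I-part : ∑[ m < q ] I-part m ≡ |I| * |S|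
      ∑I-part = trans (sum-cong-≗ λ m → x∙yz≈y∙xz *-commutativeSemigroup (𝟙 (initial? m)) |I| (suffixesFrom m))
                      (sym (*-distribˡ-sum |I| (λ m → 𝟙 (initial? m) * suffixesFrom m)))
      ∑F-part : ∑[ m < q ] F-part m ≡ |P| * |F|
      ∑F-part = trans (sum-cong-≗ λ m → sym (*-assoc (𝟙 (final? m)) (prefixesTo m) |F|))
                      (sym (*-distribʳ-sum |F| (λ m → 𝟙 (final? m) * prefixesTo m)))

x*[c*d]≤x*x*d : ∀ {x c} d → c ≤ x → x * (c * d) ≤ x * x * d
x*[c*d]≤x*x*d {x} {c} d c≤x = begin
  x * (c * d) ≡⟨ *-assoc x c d ⟨
  x * c * d   ≤⟨ *-monoˡ-≤ d (*-monoʳ-≤ x c≤x) ⟩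
  x * x * d   ∎
  where open ≤-Reasoning

weighted≤ : ∀ {a b c} g P Q → a ≤ c → b ≤ c → P + Q ≤ a * b →
            a * Q + P * b + g * (a * b) ≤ (c + g) * (a * b)
weighted≤ {a} {b} {c} g P Q a≤c b≤c P+Q≤ab = begin
  a * Q + P * b + g * (a * b) ≤⟨ +-monoˡ-≤ (g * (a * b)) (+-mono-≤ (*-monoˡ-≤ Q a≤c) (*-monoʳ-≤ P b≤c)) ⟩
  c * Q + P * c + g * (a * b) ≡⟨ solve (a ∷ b ∷ c ∷ g ∷ P ∷ Q ∷ []) ⟩
  c * (P + Q) + g * (a * b)   ≤⟨ +-monoˡ-≤ (g * (a * b)) (*-monoʳ-≤ c P+Q≤ab) ⟩
  c * (a * b) + g * (a * b)   ≡⟨ *-distribʳ-+ (a * b) c g ⟨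
  (c + g) * (a * b)           ∎
  where open ≤-Reasoning

weighted≤x²y : ∀ a b g P Q → P + Q ≤ a * b →
               ∃₂ λ x y → x + y ≡ a + b + g × a * Q + P * b + g * (a * b) ≤ x * x * y
weighted≤x²y a b g P Q P+Q≤ab with ≤-total b a
... | inj₁ b≤a = a + g , b , solve (a ∷ b ∷ g ∷ []) ,
  ≤-trans (weighted≤ g P Q ≤-refl b≤a P+Q≤ab) (x*[c*d]≤x*x*d b (m≤m+n a g))
... | inj₂ a≤b = b + g , a , solve (a ∷ b ∷ g ∷ []) ,
  ≤-trans (weighted≤ g P Q a≤b ≤-refl P+Q≤ab)
          (subst (λ n → (b + g) * n ≤ (b + g) * (b + g) * a) (*-comm b a) (x*[c*d]≤x*x*d a (m≤m+n b g)))

nonOverlapping⇒≤x²y : ∀ {q} {C : Code q 3} → Unique C → NonOverlapping C →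
                      ∃₂ λ x y → x + y ≡ q × length C ≤ x * x * y
nonOverlapping⇒≤x²y {C = C} C-unique C-nonOverlapping =
  let x , y , x+y≡ , ≤x²y = weighted≤x²y |I| |F| |G| |P| |S| |P|+|S|≤|I|*|F|
  in  x , y , trans x+y≡ |I|+|F|+|G|≡q , ≤-trans (length≤ C-unique) ≤x²y
  where open Counting C C-nonOverlapping

data Balanced : ℕ → ℕ → Set where
  even : ∀ t → Balanced (2 * t) t
  odd  : ∀ t → Balanced (suc (2 * t)) t
  odd⁺ : ∀ t → Balanced (suc (2 * t)) (suc t)

balanced-split : ∀ q → ∃₂ λ r s → Balanced r s × r + s ≡ q
balanced-split zero = 0 , 0 , even 0 , refl
balanced-split (suc q) with balanced-split q
... | _ , _ , even t , refl = _ , _ , odd t  , refl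
... | _ , _ , odd t  , refl = _ , _ , odd⁺ t , cong suc (+-suc (2 * t) t)
... | _ , _ , odd⁺ t , refl = _ , _ , even (suc t) , cong (_+ suc t) (*-suc 2 t)

[m+k*n]/n≡k : ∀ {m n} k .{{_ : NonZero n}} → m < n → (m + k * n) / n ≡ k
[m+k*n]/n≡k {m} {n} k m<n = begin
  (m + k * n) / n   ≡⟨ +-distrib-/-∣ʳ m (n∣m*n k) ⟩
  m / n + k * n / n ≡⟨ cong₂ _+_ (m<n⇒m/n≡0 m<n) (m*n/n≡m k n) ⟩
  k                 ∎
  where open ≡-Reasoning

nearest≡ : ∀ a {c} k → c < 6 → 2 * a + 3 ≡ c + k * 6 → nearest a 3 ≡ k
nearest≡ a k c<6 eq = trans (/-congˡ eq) ([m+k*n]/n≡k k c<6)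

nearest-balanced : ∀ {r s} → Balanced r s → nearest (2 * (r + s)) 3 ≡ r
nearest-balanced (even t) = nearest≡ (2 * (2 * t + t)) (2 * t) (s≤s (s≤s (s≤s (s≤s z≤n)))) (solve (t ∷ []))
nearest-balanced (odd t)  = nearest≡ (2 * (suc (2 * t) + t)) (suc (2 * t)) (s≤s (s≤s z≤n)) (solve (t ∷ []))
nearest-balanced (odd⁺ t) = nearest≡ (2 * (suc (2 * t) + suc t)) (suc (2 * t)) (n<1+n 5) (solve (t ∷ []))

-- Below y = t the slack is a polynomial in y and e = t ∸ y. Above it, only 2t (not t) is a
-- polynomial in x and f = y ∸ t ∸ 1, so both sides are doubled first.
x²y≤[2t]²t : ∀ {x y} t → x + y ≡ 2 * t + t → x * x * y ≤ 2 * t * (2 * t) * t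
x²y≤[2t]²t {x} {y} t x+y≡3t with ≤-<-connex y t
... | inj₁ y≤t with m≤n⇒∃[o]m+o≡n y≤t
...   | e , refl with +-cancelʳ-≡ y x (2 * y + 3 * e) (trans x+y≡3t (solve (y ∷ e ∷ [])))
...     | refl = begin
  (2 * y + 3 * e) * (2 * y + 3 * e) * y
    ≤⟨ m≤m+n _ _ ⟩
  (2 * y + 3 * e) * (2 * y + 3 * e) * y + (3 * y + 4 * e) * e * e
    ≡⟨ solve (y ∷ e ∷ []) ⟩
  2 * (y + e) * (2 * (y + e)) * (y + e)
    ∎
  where open ≤-Reasoning
x²y≤[2t]²t {x} {y} t x+y≡3t | inj₂ t<y with m≤n⇒∃[o]m+o≡n t<y
... | f , refl = *-cancelˡ-≤ 2 (begin
  2 * (x * x * (suc t + f))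
    ≡⟨ solve (x ∷ t ∷ f ∷ []) ⟩
  x * x * (2 * t + 2 * f + 2)
    ≡⟨ cong (λ u → x * x * (u + 2 * f + 2)) x+f+1≡2t ⟨
  x * x * (x + f + 1 + 2 * f + 2)
    ≤⟨ m≤m+n _ _ ⟩
  x * x * (x + f + 1 + 2 * f + 2) + (3 * x + f + 1) * (f + 1) * (f + 1)
    ≡⟨ solve (x ∷ f ∷ []) ⟩
  (x + f + 1) * (x + f + 1) * (x + f + 1)
    ≡⟨ cong (λ u → u * u * u) x+f+1≡2t ⟩
  2 * t * (2 * t) * (2 * t)
    ≡⟨ solve (t ∷ []) ⟩
  2 * (2 * t * (2 * t) * t)
    ∎)
  where
  open ≤-Reasoning
  x+f+1≡2t : x + f + 1 ≡ 2 * t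
  x+f+1≡2t = +-cancelʳ-≡ t (x + f + 1) (2 * t) (trans {j = x + (suc t + f)} (solve (x ∷ t ∷ f ∷ [])) x+y≡3t)

x²y≤[2t+1]²t : ∀ {x y} t → x + y ≡ suc (2 * t) + t → x * x * y ≤ suc (2 * t) * suc (2 * t) * t
x²y≤[2t+1]²t {x} {y} t x+y≡3t+1 with ≤-<-connex y t
... | inj₁ y≤t with m≤n⇒∃[o]m+o≡n y≤t
...   | e , refl with +-cancelʳ-≡ y x (2 * y + 3 * e + 1) (trans x+y≡3t+1 (solve (y ∷ e ∷ [])))
...     | refl = begin
  (2 * y + 3 * e + 1) * (2 * y + 3 * e + 1) * y
    ≤⟨ m≤m+n _ _ ⟩
  (2 * y + 3 * e + 1) * (2 * y + 3 * e + 1) * y + ((3 * y + 4 * e + 4) * e * e + (2 * y + 1) * e)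
    ≡⟨ solve (y ∷ e ∷ []) ⟩
  suc (2 * (y + e)) * suc (2 * (y + e)) * (y + e)
    ∎
  where open ≤-Reasoning
x²y≤[2t+1]²t {x} {y} t x+y≡3t+1 | inj₂ t<y with m≤n⇒∃[o]m+o≡n t<y
... | f , refl = *-cancelˡ-≤ 2 (begin
  2 * (x * x * (suc t + f))
    ≡⟨ solve (x ∷ t ∷ f ∷ []) ⟩
  x * x * (2 * t + 2 * f + 2)
    ≡⟨ cong (λ u → x * x * (u + 2 * f + 2)) x+f≡2t ⟨
  x * x * (x + f + 2 * f + 2)
    ≤⟨ m≤m+n _ _ ⟩
  x * x * (x + f + 2 * f + 2) + ((3 * x + f + 2) * f * f + (4 * x + 1) * f + x)
    ≡⟨ solve (x ∷ f ∷ []) ⟩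
  suc (x + f) * suc (x + f) * (x + f)
    ≡⟨ cong (λ u → suc u * suc u * u) x+f≡2t ⟩
  suc (2 * t) * suc (2 * t) * (2 * t)
    ≡⟨ solve (t ∷ []) ⟩
  2 * (suc (2 * t) * suc (2 * t) * t)
    ∎)
  where
  open ≤-Reasoning
  x+f≡2t : x + f ≡ 2 * t
  x+f≡2t = suc-injective (+-cancelʳ-≡ t (suc (x + f)) (suc (2 * t))
                            (trans {j = x + (suc t + f)} (solve (x ∷ t ∷ f ∷ [])) x+y≡3t+1))

x²y≤[2t+1]²[t+1] : ∀ {x y} t → x + y ≡ suc (2 * t) + suc t → x * x * y ≤ suc (2 * t) * suc (2 * t) * suc t
x²y≤[2t+1]²[t+1] {x} {y} t x+y≡3t+2 with ≤-<-connex y t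
... | inj₁ y≤t with m≤n⇒∃[o]m+o≡n y≤t
...   | e , refl with +-cancelʳ-≡ y x (2 * y + 3 * e + 2) (trans x+y≡3t+2 (solve (y ∷ e ∷ [])))
...     | refl = begin
  (2 * y + 3 * e + 2) * (2 * y + 3 * e + 2) * y
    ≤⟨ m≤m+n _ _ ⟩
  (2 * y + 3 * e + 2) * (2 * y + 3 * e + 2) * y + ((3 * y + 4 * e + 8) * e * e + (4 * y + 5) * e + y + 1)
    ≡⟨ solve (y ∷ e ∷ []) ⟩
  suc (2 * (y + e)) * suc (2 * (y + e)) * suc (y + e)
    ∎
  where open ≤-Reasoning
x²y≤[2t+1]²[t+1] {x} {y} t x+y≡3t+2 | inj₂ t<y with m≤n⇒∃[o]m+o≡n t<y
... | f , refl = *-cancelˡ-≤ 2 (begin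
  2 * (x * x * (suc t + f))
    ≡⟨ solve (x ∷ t ∷ f ∷ []) ⟩
  x * x * (suc (2 * t) + 2 * f + 1)
    ≡⟨ cong (λ u → x * x * (u + 2 * f + 1)) x+f≡2t+1 ⟨
  x * x * (x + f + 2 * f + 1)
    ≤⟨ m≤m+n _ _ ⟩
  x * x * (x + f + 2 * f + 1) + ((3 * x + f + 1) * f * f + 2 * x * f)
    ≡⟨ solve (x ∷ f ∷ []) ⟩
  (x + f) * (x + f) * suc (x + f)
    ≡⟨ cong (λ u → u * u * suc u) x+f≡2t+1 ⟩
  suc (2 * t) * suc (2 * t) * suc (suc (2 * t))
    ≡⟨ solve (t ∷ []) ⟩
  2 * (suc (2 * t) * suc (2 * t) * suc t)
    ∎)
  where
  open ≤-Reasoning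
  x+f≡2t+1 : x + f ≡ suc (2 * t)
  x+f≡2t+1 = +-cancelʳ-≡ (suc t) (x + f) (suc (2 * t))
               (trans {j = x + (suc t + f)} (solve (x ∷ t ∷ f ∷ [])) x+y≡3t+2)

x²y≤r²s : ∀ {r s x y} → Balanced r s → x + y ≡ r + s → x * x * y ≤ r * r * s
x²y≤r²s {x = x} {y} (even t) = x²y≤[2t]²t {x} {y} t
x²y≤r²s {x = x} {y} (odd t)  = x²y≤[2t+1]²t {x} {y} t
x²y≤r²s {x = x} {y} (odd⁺ t) = x²y≤[2t+1]²[t+1] {x} {y} t

length-cartesianProduct : ∀ {A B : Set} (xs : List A) (ys : List B) →
                          length (cartesianProduct xs ys) ≡ length xs * length ys
length-cartesianProduct []       ys = refl
length-cartesianProduct (x ∷ xs) ys =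
  trans (length-++ (map (x ,_) ys)) (cong₂ _+_ (length-map (x ,_) ys) (length-cartesianProduct xs ys))

module _ (r s : ℕ) where

  open import Data.Vec using ([]; _∷_)

  ↑ˡ≢↑ʳ : (a : Fin r) (b : Fin s) → a ↑ˡ s ≢ r ↑ʳ b
  ↑ˡ≢↑ʳ a b eq with trans (sym (splitAt-↑ˡ r a s)) (trans (cong (splitAt r) eq) (splitAt-↑ʳ r s b))
  ... | ()

  blockWord : Fin r × Fin r × Fin s → Word (r + s) 3
  blockWord (a , m , b) = (a ↑ˡ s) ∷ (m ↑ˡ s) ∷ (r ↑ʳ b) ∷ []

  blockWord-injective : ∀ {p p'} → blockWord p ≡ blockWord p' → p ≡ p'
  blockWord-injective eq =
    cong₂ _,_ (↑ˡ-injective s _ _ (cong (λ w → lookup w 0F) eq))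
              (cong₂ _,_ (↑ˡ-injective s _ _ (cong (λ w → lookup w 1F) eq))
                         (↑ʳ-injective r _ _ (cong (λ w → lookup w 2F) eq)))

  blockWord-nonOverlapping : ∀ p p' → ¬ Overlapping (blockWord p) (blockWord p')
  blockWord-nonOverlapping _ _ (0 , () , _)
  blockWord-nonOverlapping (a , _ , b) (a' , _ , b') (1 , _ , _ , inj₁ eq) = ↑ˡ≢↑ʳ a  b' (∷-injectiveˡ eq)
  blockWord-nonOverlapping (a , _ , b) (a' , _ , b') (1 , _ , _ , inj₂ eq) = ↑ˡ≢↑ʳ a' b  (∷-injectiveˡ eq)
  blockWord-nonOverlapping (_ , m , b) (_ , m' , b') (2 , _ , _ , inj₁ eq) = ↑ˡ≢↑ʳ m  b' (∷-injectiveˡ (∷-injectiveʳ eq))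
  blockWord-nonOverlapping (_ , m , b) (_ , m' , b') (2 , _ , _ , inj₂ eq) = ↑ˡ≢↑ʳ m' b  (∷-injectiveˡ (∷-injectiveʳ eq))
  blockWord-nonOverlapping _ _ (suc (suc (suc _)) , _ , s≤s (s≤s (s≤s ())) , _)

  triples : List (Fin r × Fin r × Fin s)
  triples = cartesianProduct (allFin r) (cartesianProduct (allFin r) (allFin s))

  blockCode : Code (r + s) 3
  blockCode = map blockWord triples

  blockCode-unique : Unique blockCode
  blockCode-unique = map⁺ blockWord-injective (cartesianProduct⁺ (allFin⁺ r) (cartesianProduct⁺ (allFin⁺ r) (allFin⁺ s)))

  blockCode-nonOverlapping : NonOverlapping blockCode
  blockCode-nonOverlapping u∈ v∈ with ∈-map⁻ blockWord u∈ | ∈-map⁻ blockWord v∈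
  ... | p , _ , refl | p' , _ , refl = blockWord-nonOverlapping p p'

  length-blockCode : length blockCode ≡ r * r * s
  length-blockCode = begin
    length blockCode
      ≡⟨ length-map blockWord triples ⟩
    length triples
      ≡⟨ length-cartesianProduct (allFin r) (cartesianProduct (allFin r) (allFin s)) ⟩
    length (allFin r) * length (cartesianProduct (allFin r) (allFin s))
      ≡⟨ cong (length (allFin r) *_) (length-cartesianProduct (allFin r) (allFin s)) ⟩
    length (allFin r) * (length (allFin r) * length (allFin s))
      ≡⟨ cong₂ _*_ (length-allFin r) (cong₂ _*_ (length-allFin r) (length-allFin s)) ⟩
    r * (r * s)
      ≡⟨ *-assoc r r s ⟨
    r * r * s
      ∎
    where
    open ≡-Reasoning
    length-allFin : ∀ n → length (allFin n) ≡ n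
    length-allFin n = length-tabulate {n = n} (λ i → i)

theorem7 : ∀ (q : ℕ) → 2 ≤ q →
    IsMaxNonOverlapping 3 q (nearest (2 * q) 3 * nearest (2 * q) 3 * (q ∸ nearest (2 * q) 3))
theorem7 q _ with balanced-split q
... | r , s , rs-balanced , refl rewrite nearest-balanced rs-balanced | m+n∸m≡n r s =
  (blockCode r s , blockCode-unique r s , blockCode-nonOverlapping r s , length-blockCode r s) ,
  λ C C-unique C-nonOverlapping →
    let x , y , x+y≡r+s , length≤x²y = nonOverlapping⇒≤x²y C-unique C-nonOverlapping
    in  ≤-trans length≤x²y (x²y≤r²s {x = x} {y} rs-balanced x+y≡r+s)
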